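{- The Cévenol graph is a proper chordal graph but not a rooted directed path graph.
   Context: The Cévenol graph has vertex set $\{a,b,c,d,e,f,g,h\}$ and edge set $\{ab,ac,ad,ae,af,bc,cd,de,ef,dg,dh,gh,ag\}$. A graph is a rooted directed path graph if it is the intersection graph of a family of directed paths of a rooted tree, a directed path being a subpath of a path from the root to a leaf. A tree-layout of $G=(V,E)$ is a triple $(T,r,\rho)$ with $T$ a tree on $|V|$ nodes rooted at $r$ and $\rho:V\to V(T)$ a bijection such that for every edge $xy$, $\rho(x)$ is an ancestor of $\rho(y)$ or vice versa; write $u\prec v$ if $\rho(u)$ is a proper ancestor of $\rho(v)$. $G$ is proper chordal if it admits a tree-layout with no three vertices $x\prec y\prec z$ such that $xz\in E$ and exactly one of $xy,yz$ is in $E$. -}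

module Defs where

open import Data.Nat using (ℕ; suc; _≤_)
open import Data.Fin using (Fin; zero; suc; toℕ)
open import Data.Product using (Σ; ∃; _×_; _,_)
open import Data.Sum using (_⊎_)
open import Data.Empty using (⊥)
open import Relation.Nullary using (¬_)
open import Relation.Binary.PropositionalEquality using (_≡_; _≢_)
open import Function.Bundles using (_⤖_; _⇔_; Bijection)
open Bijection using (to)

-- A rooted tree with (suc size) nodes is given by parent pointers on the
-- nodes Fin (suc size): node 0 is the root, and node (suc i) has parent
-- (parent i), whose index is at most i (nodes are listed in an order where
-- parents precede children).  Every finite rooted tree arises this way up to
-- isomorphism, and every such parent function defines a rooted tree.

record RootedTree : Set where
  field
    size    : ℕ
    parent  : Fin size → Fin (suc size)
    parent< : (i : Fin size) → toℕ (parent i) ≤ toℕ i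

module _ (T : RootedTree) where
  open RootedTree T

  Node : Set
  Node = Fin (suc size)

  root : Node
  root = zero

  -- x ≼ y : x is an ancestor of y (reflexive: x ≼ x).
  data _≼_ : Node → Node → Set where
    here : ∀ {x} → x ≼ x
    up   : ∀ {x i} → x ≼ parent i → x ≼ suc i

  _≺_ : Node → Node → Set
  x ≺ y = x ≼ y × x ≢ y

  -- A directed path: a subpath of a path from the root to a leaf.
  -- It is determined by its top node and bottom node, the top being an
  -- ancestor of the bottom; it consists of the nodes w with top ≼ w ≼ bottom.
  record DirectedPath : Set where
    constructor dpath
    field
      top    : Node
      bottom : Node
      top≼bottom : top ≼ bottom

  _∈P_ : Node → DirectedPath → Set
  w ∈P dpath t b _ = t ≼ w × w ≼ b

open RootedTree public

IsRDPG : (V : Set) (Adj : V → V → Set) → Set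
IsRDPG V Adj =
  Σ RootedTree λ T →
  Σ (V → DirectedPath T) λ P →
  ∀ u v → u ≢ v → (Adj u v ⇔ ∃ λ w → (_∈P_ T w (P u) × _∈P_ T w (P v)))

record TreeLayout (V : Set) (Adj : V → V → Set) : Set where
  field
    tree  : RootedTree
    ρ     : V ⤖ Node tree
    edges : ∀ x y → Adj x y →
              _≼_ tree (to ρ x) (to ρ y) ⊎ _≼_ tree (to ρ y) (to ρ x)

  _≺ᵥ_ : V → V → Set
  u ≺ᵥ v = _≺_ tree (to ρ u) (to ρ v)

IsProperChordal : (V : Set) (Adj : V → V → Set) → Set
IsProperChordal V Adj =
  Σ (TreeLayout V Adj) λ L → let open TreeLayout L in
  ¬ (∃ λ x → ∃ λ y → ∃ λ z →
       x ≺ᵥ y × y ≺ᵥ z × Adj x z ×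
       ((Adj x y × ¬ Adj y z) ⊎ (¬ Adj x y × Adj y z)))

data CV : Set where
  a b c d e f g h : CV

data CevEdge : CV → CV → Set where
  ab : CevEdge a b
  ac : CevEdge a c
  ad : CevEdge a d
  ae : CevEdge a e
  af : CevEdge a f
  bc : CevEdge b c
  cd : CevEdge c d
  de : CevEdge d e
  ef : CevEdge e f
  dg : CevEdge d g
  dh : CevEdge d h
  gh : CevEdge g h
  ag : CevEdge a g

CevAdj : CV → CV → Set
CevAdj x y = CevEdge x y ⊎ CevEdge y x

module Submission where

-- Proper chordality is witnessed by the layout with root-to-leaf paths g d a c b, g d a e f and
-- g d h: there every vertex strictly between the ends of an edge is adjacent to both ends, a
-- finite property that is decided by computation.
--
-- Now suppose the vertices are represented by directed paths P v with tops t v.  Directed paths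
-- have the Helly property, so the triangles adg and dgh give nodes w₁ ∈ a∩d∩g and w₀ ∈ d∩g∩h,
-- both on P d and hence comparable.  If w₁ ⊑ w₀, the triangles acd and abc force t d onto P c.
-- Otherwise t a lies on P d and P g; then the tops of b, c, e lie on P a, those of c, e on P d,
-- and comparing t c with t e puts t b on P d or t e on P c.  Each argument is made once: the
-- automorphism swapping b, c with f, e supplies its mirror image, and in the first case t d
-- would then lie on both P c and P e, although c and e are not adjacent.

open import Defs
open import Data.Nat as ℕ using (suc; s≤s)
open import Data.Nat.Properties using (≤-refl; ≤-trans)
open import Data.Fin using (Fin; zero; suc; toℕ; #_; _≟_)
open import Data.Fin.Properties using (all?)
open import Data.Vec using ([]; _∷_; lookup)
open import Data.Product using (∃; _×_; _,_; proj₁; proj₂)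
open import Data.Sum using (_⊎_; inj₁; inj₂; [_,_]; swap)
open import Data.Empty using (⊥; ⊥-elim)
open import Relation.Nullary using (¬_; Dec; yes; no)
open import Relation.Nullary.Decidable using (map′; _×-dec_; _⊎-dec_; _→-dec_; ¬?; from-yes)
open import Relation.Binary.Definitions using (Decidable)
open import Relation.Binary.PropositionalEquality using (_≡_; _≢_; refl; cong; subst; subst₂)
open import Function.Base using (_∘_; id)
open import Function.Bundles using (_⇔_; mk⇔; mk↔ₛ′; Equivalence)
open import Function.Properties.Inverse using (↔⇒⤖)
open import Function.Construct.Composition using (_⇔-∘_)

all?-enumerated : ∀ {n} {A : Set} {P : A → Set} (enum : Fin n → A) (index : A → Fin n) →
                  (∀ x → enum (index x) ≡ x) → (∀ x → Dec (P x)) → Dec (∀ x → P x)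
all?-enumerated {P = P} enum index enum-index P? =
  map′ (λ ∀P x → subst P (enum-index x) (∀P (index x))) (λ ∀P i → ∀P (enum i)) (all? (P? ∘ enum))

module RootedTreeProperties (T : RootedTree) where

  infix 4 _⊑_ _∈ₚ_

  _⊑_ : Node T → Node T → Set
  _⊑_ = _≼_ T

  open DirectedPath public using (top; bottom; top≼bottom)

  -- A record rather than _∈P_ itself, so that the path can be inferred from a membership proof.
  record _∈ₚ_ (w : Node T) (Q : DirectedPath T) : Set where
    constructor within
    field
      from-top  : top Q ⊑ w
      to-bottom : w ⊑ bottom Q

  open _∈ₚ_ public

  private
    variable
      x y z u v w : Node T
      i : Fin (size T)
      Q R S : DirectedPath T

  ≼-trans : x ⊑ y → y ⊑ z → x ⊑ z
  ≼-trans p here   = p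
  ≼-trans p (up q) = up (≼-trans p q)

  ≼-comparable : x ⊑ z → y ⊑ z → x ⊑ y ⊎ y ⊑ x
  ≼-comparable here   q      = inj₂ q
  ≼-comparable (up p) here   = inj₁ (up p)
  ≼-comparable (up p) (up q) = ≼-comparable p q

  ⋢⇒⊒ : x ⊑ z → y ⊑ z → ¬ x ⊑ y → y ⊑ x
  ⋢⇒⊒ x⊑z y⊑z x⋢y = [ ⊥-elim ∘ x⋢y , id ] (≼-comparable x⊑z y⊑z)

  ≼-zero⁻¹ : x ⊑ zero → x ≡ zero
  ≼-zero⁻¹ here = refl

  ≼-suc⁻¹ : x ⊑ suc i → x ≢ suc i → x ⊑ parent T i
  ≼-suc⁻¹ here   x≢ = ⊥-elim (x≢ refl)
  ≼-suc⁻¹ (up p) _  = p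

  -- The bound on toℕ y is the fuel: parents have smaller indices.
  ≼?-bounded : ∀ n x y → toℕ y ℕ.≤ n → Dec (x ⊑ y)
  ≼?-bounded _       x zero    _         = map′ (λ { refl → here }) ≼-zero⁻¹ (x ≟ zero)
  ≼?-bounded (suc n) x (suc i) (s≤s i≤n) with x ≟ suc i
  ... | yes refl = yes here
  ... | no x≢    = map′ up (λ p → ≼-suc⁻¹ p x≢)
                        (≼?-bounded n x (parent T i) (≤-trans (parent< T i) i≤n))

  _≼?_ : Decidable _⊑_
  x ≼? y = ≼?-bounded (toℕ y) x y ≤-refl

  _≺?_ : Decidable (_≺_ T)
  x ≺? y = x ≼? y ×-dec ¬? (x ≟ y)

  top∈ : ∀ Q → top Q ∈ₚ Q
  top∈ Q = within here (top≼bottom Q)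

  ∈-convex : u ∈ₚ Q → v ∈ₚ Q → u ⊑ w → w ⊑ v → w ∈ₚ Q
  ∈-convex u∈Q v∈Q u⊑w w⊑v = within (≼-trans (from-top u∈Q) u⊑w) (≼-trans w⊑v (to-bottom v∈Q))

  Meet : DirectedPath T → DirectedPath T → Set
  Meet Q R = ∃ λ w → w ∈ₚ Q × w ∈ₚ R

  meet⇒top∈ : Meet Q R → top R ∈ₚ Q ⊎ top Q ∈ₚ R
  meet⇒top∈ (w , within tQ⊑w w⊑bQ , within tR⊑w w⊑bR) with ≼-comparable tQ⊑w tR⊑w
  ... | inj₁ tQ⊑tR = inj₁ (within tQ⊑tR (≼-trans tR⊑w w⊑bQ))
  ... | inj₂ tR⊑tQ = inj₂ (within tR⊑tQ (≼-trans tQ⊑w w⊑bR))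

  meet∧top∉⇒top∈ : Meet Q R → ¬ top Q ∈ₚ R → top R ∈ₚ Q
  meet∧top∉⇒top∈ m tQ∉R = [ id , ⊥-elim ∘ tQ∉R ] (meet⇒top∈ m)

  helly-top : top Q ∈ₚ R → Meet R S → Meet Q S → ∃ λ w → w ∈ₚ Q × w ∈ₚ R × w ∈ₚ S
  helly-top {Q} {R} {S} tQ∈R mRS mQS with meet⇒top∈ mQS
  ... | inj₂ tQ∈S = top Q , top∈ Q , tQ∈R , tQ∈S
  ... | inj₁ tS∈Q with meet⇒top∈ mRS
  ...   | inj₁ tS∈R = top S , tS∈Q , tS∈R , top∈ S
  ...   | inj₂ tR∈S = top S , tS∈Q , tS∈R , top∈ S
    where
    tS∈R : top S ∈ₚ R
    tS∈R = within (≼-trans (from-top tQ∈R) (from-top tS∈Q)) (≼-trans (from-top tR∈S) (top≼bottom R))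

  helly : Meet Q R → Meet R S → Meet Q S → ∃ λ w → w ∈ₚ Q × w ∈ₚ R × w ∈ₚ S
  helly mQR mRS mQS with meet⇒top∈ mQR
  ... | inj₂ tQ∈R = helly-top tQ∈R mRS mQS
  ... | inj₁ tR∈Q with helly-top tR∈Q mQS mRS
  ...   | w , w∈R , w∈Q , w∈S = w , w∈Q , w∈R , w∈S

  Represents : {V : Set} → (V → V → Set) → (V → DirectedPath T) → Set
  Represents Adj P = ∀ u v → u ≢ v → (Adj u v ⇔ ∃ λ w → _∈P_ T w (P u) × _∈P_ T w (P v))

  represents-∘-automorphism : {V : Set} {Adj : V → V → Set} {P : V → DirectedPath T} (σ : V → V) →
                              (∀ {u v} → σ u ≡ σ v → u ≡ v) → (∀ u v → Adj u v ⇔ Adj (σ u) (σ v)) →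
                              Represents Adj P → Represents Adj (P ∘ σ)
  represents-∘-automorphism σ σ-injective σ-adj rep u v u≢v =
    rep (σ u) (σ v) (u≢v ∘ σ-injective) ⇔-∘ σ-adj u v

module _ {V : Set} {Adj : V → V → Set} (L : TreeLayout V Adj) where
  open TreeLayout L

  InteriorAdjacent : Set
  InteriorAdjacent = ∀ x y z → x ≺ᵥ y → y ≺ᵥ z → Adj x z → Adj x y × Adj y z

  interiorAdjacent⇒properChordal : InteriorAdjacent → IsProperChordal V Adj
  interiorAdjacent⇒properChordal adjacent = L , λ where
    (x , y , z , x≺y , y≺z , xz , inj₁ (xy , ¬yz)) → ¬yz (proj₂ (adjacent x y z x≺y y≺z xz))
    (x , y , z , x≺y , y≺z , xz , inj₂ (¬xy , yz)) → ¬xy (proj₁ (adjacent x y z x≺y y≺z xz))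

adjacent-irreflexive : ∀ {x} → ¬ CevAdj x x
adjacent-irreflexive (inj₁ ())
adjacent-irreflexive (inj₂ ())

adjacent⇒≢ : ∀ {x y} → CevAdj x y → x ≢ y
adjacent⇒≢ xy refl = adjacent-irreflexive xy

edge? : Decidable CevEdge
edge? = λ
  { a a → no λ () ; a b → yes ab ; a c → yes ac ; a d → yes ad ; a e → yes ae ; a f → yes af ; a g → yes ag ; a h → no λ ()
  ; b a → no λ () ; b b → no λ () ; b c → yes bc ; b d → no λ () ; b e → no λ () ; b f → no λ () ; b g → no λ () ; b h → no λ ()
  ; c a → no λ () ; c b → no λ () ; c c → no λ () ; c d → yes cd ; c e → no λ () ; c f → no λ () ; c g → no λ () ; c h → no λ ()
  ; d a → no λ () ; d b → no λ () ; d c → no λ () ; d d → no λ () ; d e → yes de ; d f → no λ () ; d g → yes dg ; d h → yes dh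
  ; e a → no λ () ; e b → no λ () ; e c → no λ () ; e d → no λ () ; e e → no λ () ; e f → yes ef ; e g → no λ () ; e h → no λ ()
  ; f a → no λ () ; f b → no λ () ; f c → no λ () ; f d → no λ () ; f e → no λ () ; f f → no λ () ; f g → no λ () ; f h → no λ ()
  ; g a → no λ () ; g b → no λ () ; g c → no λ () ; g d → no λ () ; g e → no λ () ; g f → no λ () ; g g → no λ () ; g h → yes gh
  ; h a → no λ () ; h b → no λ () ; h c → no λ () ; h d → no λ () ; h e → no λ () ; h f → no λ () ; h g → no λ () ; h h → no λ ()
  }

adjacent? : Decidable CevAdj
adjacent? x y = edge? x y ⊎-dec edge? y x

layoutParent : Fin 7 → Fin 8
layoutParent = lookup (# 0 ∷ # 1 ∷ # 2 ∷ # 3 ∷ # 2 ∷ # 5 ∷ # 1 ∷ [])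

layoutTree : RootedTree
layoutTree = record
  { size    = 7
  ; parent  = layoutParent
  ; parent< = from-yes (all? λ i → toℕ (layoutParent i) ℕ.≤? toℕ i)
  }

vertexAt : Fin 8 → CV
vertexAt = lookup (g ∷ d ∷ a ∷ c ∷ b ∷ e ∷ f ∷ h ∷ [])

position : CV → Fin 8
position = λ { a → # 2 ; b → # 4 ; c → # 3 ; d → # 1 ; e → # 5 ; f → # 6 ; g → # 0 ; h → # 7 }

vertexAt-position : ∀ x → vertexAt (position x) ≡ x
vertexAt-position = λ { a → refl ; b → refl ; c → refl ; d → refl ; e → refl ; f → refl ; g → refl ; h → refl }

position-vertexAt : ∀ i → position (vertexAt i) ≡ i
position-vertexAt = from-yes (all? λ i → position (vertexAt i) ≟ i)

all-CV? : {P : CV → Set} → (∀ x → Dec (P x)) → Dec (∀ x → P x)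
all-CV? = all?-enumerated vertexAt position vertexAt-position

module _ where
  open RootedTreeProperties layoutTree

  cevenolLayout : TreeLayout CV CevAdj
  cevenolLayout = record
    { tree  = layoutTree
    ; ρ     = ↔⇒⤖ (mk↔ₛ′ position vertexAt position-vertexAt vertexAt-position)
    ; edges = from-yes (all-CV? λ x → all-CV? λ y →
                adjacent? x y →-dec (position x ≼? position y ⊎-dec position y ≼? position x))
    }

  cevenolLayout-interiorAdjacent : InteriorAdjacent cevenolLayout
  cevenolLayout-interiorAdjacent = from-yes (all-CV? λ x → all-CV? λ y → all-CV? λ z →
    position x ≺? position y →-dec position y ≺? position z →-dec adjacent? x z →-dec
    (adjacent? x y ×-dec adjacent? y z))

mirror : CV → CV
mirror = λ { a → a ; b → f ; c → e ; d → d ; e → c ; f → b ; g → g ; h → h }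

mirror-involutive : ∀ x → mirror (mirror x) ≡ x
mirror-involutive = λ { a → refl ; b → refl ; c → refl ; d → refl ; e → refl ; f → refl ; g → refl ; h → refl }

mirror-injective : ∀ {x y} → mirror x ≡ mirror y → x ≡ y
mirror-injective {x} {y} eq = subst₂ _≡_ (mirror-involutive x) (mirror-involutive y) (cong mirror eq)

mirror-edge : ∀ {x y} → CevEdge x y → CevAdj (mirror x) (mirror y)
mirror-edge ab = inj₁ af
mirror-edge ac = inj₁ ae
mirror-edge ad = inj₁ ad
mirror-edge ae = inj₁ ac
mirror-edge af = inj₁ ab
mirror-edge bc = inj₂ ef
mirror-edge cd = inj₂ de
mirror-edge de = inj₂ cd
mirror-edge ef = inj₂ bc
mirror-edge dg = inj₁ dg
mirror-edge dh = inj₁ dh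
mirror-edge gh = inj₁ gh
mirror-edge ag = inj₁ ag

mirror-adjacent : ∀ {x y} → CevAdj x y → CevAdj (mirror x) (mirror y)
mirror-adjacent = [ mirror-edge , swap ∘ mirror-edge ]

mirror-automorphism : ∀ x y → CevAdj x y ⇔ CevAdj (mirror x) (mirror y)
mirror-automorphism x y = mk⇔ mirror-adjacent
  (subst₂ CevAdj (mirror-involutive x) (mirror-involutive y) ∘ mirror-adjacent)

module CevenolPaths (T : RootedTree) (P : CV → DirectedPath T)
                    (represents : RootedTreeProperties.Represents T CevAdj P) where
  open RootedTreeProperties T

  infix 4 _∈_
  _∈_ : Node T → CV → Set
  w ∈ v = w ∈ₚ P v

  t : CV → Node T
  t v = top (P v)

  meet : ∀ {u v} → CevAdj u v → Meet (P u) (P v)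
  meet {u} {v} uv with Equivalence.to (represents u v (adjacent⇒≢ uv)) uv
  ... | w , (p , q) , (r , s) = w , within p q , within r s

  disjoint : ∀ {u v w} → u ≢ v → ¬ CevAdj u v → w ∈ u → w ∈ v → ⊥
  disjoint {u} {v} {w} u≢v ¬uv w∈u w∈v = ¬uv (Equivalence.from (represents u v u≢v)
    (w , (from-top w∈u , to-bottom w∈u) , (from-top w∈v , to-bottom w∈v)))

  a∩h≡∅ : ∀ {w} → w ∈ a → w ∈ h → ⊥
  a∩h≡∅ = disjoint (λ ()) λ { (inj₁ ()) ; (inj₂ ()) }

  b∩d≡∅ : ∀ {w} → w ∈ b → w ∈ d → ⊥
  b∩d≡∅ = disjoint (λ ()) λ { (inj₁ ()) ; (inj₂ ()) }

  c∩e≡∅ : ∀ {w} → w ∈ c → w ∈ e → ⊥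
  c∩e≡∅ = disjoint (λ ()) λ { (inj₁ ()) ; (inj₂ ()) }

  c∩g≡∅ : ∀ {w} → w ∈ c → w ∈ g → ⊥
  c∩g≡∅ = disjoint (λ ()) λ { (inj₁ ()) ; (inj₂ ()) }

  e∩g≡∅ : ∀ {w} → w ∈ e → w ∈ g → ⊥
  e∩g≡∅ = disjoint (λ ()) λ { (inj₁ ()) ; (inj₂ ()) }

  module TopOfAInDG (ta∈d : t a ∈ d) (ta∈g : t a ∈ g) where

    tb∈a : t b ∈ a
    tb∈a = meet∧top∉⇒top∈ (meet (inj₁ ab)) λ ta∈b → b∩d≡∅ ta∈b ta∈d

    tc∈a : t c ∈ a
    tc∈a = meet∧top∉⇒top∈ (meet (inj₁ ac)) λ ta∈c → c∩g≡∅ ta∈c ta∈g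

    te∈a : t e ∈ a
    te∈a = meet∧top∉⇒top∈ (meet (inj₁ ae)) λ ta∈e → e∩g≡∅ ta∈e ta∈g

    -- If t d lay on P v, then t v ⊑ t d ⊑ t a ⊑ t v would put t a on P v.
    top∈d : ∀ {v} → CevAdj v d → t v ∈ a → ¬ t a ∈ v → t v ∈ d
    top∈d vd tv∈a ta∉v = meet∧top∉⇒top∈ (meet (swap vd)) λ td∈v →
      ta∉v (∈-convex (top∈ (P _)) td∈v (≼-trans (from-top td∈v) (from-top ta∈d))
                                        (≼-trans (from-top tv∈a) (from-top td∈v)))

    tc∈d : t c ∈ d
    tc∈d = top∈d (inj₁ cd) tc∈a λ ta∈c → c∩g≡∅ ta∈c ta∈g

    te∈d : t e ∈ d
    te∈d = top∈d (inj₂ de) te∈a λ ta∈e → e∩g≡∅ ta∈e ta∈g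

    tb∈c : t b ∈ c
    tb∈c = meet∧top∉⇒top∈ (meet (inj₂ bc)) λ tc∈b → b∩d≡∅ tc∈b tc∈d

    tc⋢te : ¬ t c ⊑ t e
    tc⋢te tc⊑te with ≼-comparable (to-bottom tb∈a) (to-bottom te∈a)
    ... | inj₁ tb⊑te = b∩d≡∅ (top∈ (P b)) (∈-convex tc∈d te∈d (from-top tb∈c) tb⊑te)
    ... | inj₂ te⊑tb = c∩e≡∅ (∈-convex (top∈ (P c)) tb∈c tc⊑te te⊑tb) (top∈ (P e))

  module ADGAboveDGH {N W : Node T} (N∈a : N ∈ a) (N∈d : N ∈ d) (N∈g : N ∈ g)
                     (W∈d : W ∈ d) (W∈g : W ∈ g) (W∈h : W ∈ h) (N⊑W : N ⊑ W) where

    a∩d∖g-below-N : ∀ {x} → x ∈ a → x ∈ d → ¬ x ∈ g → x ⊑ N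
    a∩d∖g-below-N x∈a x∈d x∉g = ⋢⇒⊒ (to-bottom N∈a) (to-bottom x∈a) λ N⊑x →
      [ (λ x⊑W → x∉g (∈-convex N∈g W∈g N⊑x x⊑W)) , (λ W⊑x → a∩h≡∅ (∈-convex N∈a x∈a N⊑W W⊑x) W∈h) ]
        (≼-comparable (to-bottom x∈d) (to-bottom W∈d))

    td∈c : t d ∈ c
    td∈c with helly (meet (inj₁ ac)) (meet (inj₁ cd)) (meet (inj₁ ad))
             | helly (meet (inj₁ ab)) (meet (inj₁ bc)) (meet (inj₁ ac))
    ... | x , x∈a , x∈c , x∈d | y , y∈a , y∈b , y∈c = ∈-convex y∈c x∈c y⊑td (from-top x∈d)
      where
      x⊑N : x ⊑ N
      x⊑N = a∩d∖g-below-N x∈a x∈d (c∩g≡∅ x∈c)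
      y⊑N : y ⊑ N
      y⊑N = ⋢⇒⊒ (to-bottom N∈a) (to-bottom y∈a) λ N⊑y → c∩g≡∅ (∈-convex x∈c y∈c x⊑N N⊑y) N∈g
      y⊑td : y ⊑ t d
      y⊑td = ⋢⇒⊒ (from-top N∈d) y⊑N λ td⊑y → b∩d≡∅ y∈b (∈-convex (top∈ (P d)) N∈d td⊑y y⊑N)

module CevenolNotRepresentable (T : RootedTree) (P : CV → DirectedPath T)
                               (represents : RootedTreeProperties.Represents T CevAdj P) where
  open RootedTreeProperties T
  open CevenolPaths T P represents
  module Mirrored = CevenolPaths T (P ∘ mirror)
    (represents-∘-automorphism {P = P} mirror mirror-injective mirror-automorphism represents)

  top-a∉d∩g : t a ∈ d → t a ∈ g → ⊥
  top-a∉d∩g ta∈d ta∈g =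
    [ tc⋢te , Mirrored.TopOfAInDG.tc⋢te ta∈d ta∈g ] (≼-comparable (to-bottom tc∈a) (to-bottom te∈a))
    where open TopOfAInDG ta∈d ta∈g

  a∩d∩g⋢d∩g∩h : ∀ {N W} → N ∈ a → N ∈ d → N ∈ g → W ∈ d → W ∈ g → W ∈ h → ¬ N ⊑ W
  a∩d∩g⋢d∩g∩h N∈a N∈d N∈g W∈d W∈g W∈h N⊑W =
    c∩e≡∅ (ADGAboveDGH.td∈c N∈a N∈d N∈g W∈d W∈g W∈h N⊑W)
          (Mirrored.ADGAboveDGH.td∈c N∈a N∈d N∈g W∈d W∈g W∈h N⊑W)

  absurd : ⊥
  absurd with helly (meet (inj₁ ad)) (meet (inj₁ dg)) (meet (inj₁ ag))
            | helly (meet (inj₁ dg)) (meet (inj₁ gh)) (meet (inj₁ dh))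
  ... | w₁ , w₁∈a , w₁∈d , w₁∈g | w₀ , w₀∈d , w₀∈g , w₀∈h
      with ≼-comparable (to-bottom w₁∈d) (to-bottom w₀∈d)
  ... | inj₁ w₁⊑w₀ = a∩d∩g⋢d∩g∩h w₁∈a w₁∈d w₁∈g w₀∈d w₀∈g w₀∈h w₁⊑w₀
  ... | inj₂ w₀⊑w₁ with ≼-comparable (from-top w₁∈a) w₀⊑w₁
  ...   | inj₁ ta⊑w₀ = a∩h≡∅ (∈-convex (top∈ (P a)) w₁∈a ta⊑w₀ w₀⊑w₁) w₀∈h
  ...   | inj₂ w₀⊑ta = top-a∉d∩g (∈-convex w₀∈d w₁∈d w₀⊑ta (from-top w₁∈a))
                                 (∈-convex w₀∈g w₁∈g w₀⊑ta (from-top w₁∈a))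

mainTheorem17 : IsProperChordal CV CevAdj × ¬ IsRDPG CV CevAdj
mainTheorem17 = interiorAdjacent⇒properChordal cevenolLayout cevenolLayout-interiorAdjacent
              , λ (T , P , represents) → CevenolNotRepresentable.absurd T P represents
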